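{- Let $a,d,k,m,l$ be positive integers with $a+kd\le m$ and $l\ge m$, and define $$I=[a-1]\cup\{\,i\in[l]\setminus\{a+jd:0\le j\le k\}\;:\; \text{for all } 0\le j\le k,\ a+jd<i \Rightarrow l-i<m-(a+jd)\,\}.$$ Then $I=\emptyset$ if and only if $a=1$, $m=kd+1$, and $l\ge d(k+1)$.
   Context: $[n]=\{1,\dots,n\}$ for a nonnegative integer $n$, with $[0]=\emptyset$. -}

module Defs where

open import Data.Nat using (ℕ; _+_; _*_; _∸_; _≤_; _<_)
open import Data.Product using (_×_)
open import Data.Sum using (_⊎_)
open import Relation.Nullary using (¬_)
open import Relation.Binary.PropositionalEquality using (_≢_)

_∈[_] : ℕ → ℕ → Set
i ∈[ n ] = 1 ≤ i × i ≤ n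

ap : ℕ → ℕ → ℕ → ℕ
ap a d j = a + j * d

-- i ∈ I, where
-- I = [a-1] ∪ { i ∈ [l] \ {a+jd : 0≤j≤k} : ∀ 0≤j≤k, a+jd < i ⇒ l-i < m-(a+jd) }.
-- (Under the hypotheses a+kd ≤ m and i ≤ l the truncated subtractions are exact.)
InI : (a d k m l i : ℕ) → Set
InI a d k m l i =
  i ∈[ a ∸ 1 ]
  ⊎ ( i ∈[ l ]
    × (∀ j → j ≤ k → i ≢ ap a d j)
    × (∀ j → j ≤ k → ap a d j < i → l ∸ i < m ∸ ap a d j))

IEmpty : (a d k m l : ℕ) → Set
IEmpty a d k m l = ∀ i → ¬ InI a d k m l i

-- If a ≥ 2 then 1 ∈ [a-1] ⊆ I, and if m > a + kd then l ∈ I: it exceeds the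
-- whole progression and l - l = 0 < m - (a + jd).  So let a = 1, m = 1 + kd.
-- For an element i of the second part, i > 1 + jd forces l - i < (k - j)d,
-- i.e. i > l - (k - j)d ≥ (j + 1)d, so i > 1 + (j + 1)d as i avoids the
-- progression; when l ≥ d(k + 1) this climbs to i > 1 + kd, where the
-- condition reads l - i < 0.  When l < d(k + 1) and d ≥ 2 the climb fails at
-- i = kd, which lies strictly between 1 + (k - 1)d and 1 + kd with l - kd < d.
module Submission where

open import Defs
open import Data.Nat using (ℕ; zero; suc; _+_; _*_; _∸_; _≤_; _<_; z≤n; s≤s; z<s; _≤?_; >-nonZero)
open import Data.Nat.Properties
open import Data.Nat.Solver using (module +-*-Solver)
open import Data.Product using (_×_; _,_)
open import Data.Sum using (inj₁; inj₂)
open import Data.Empty using (⊥-elim)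
open import Relation.Nullary using (¬_; yes; no)
open import Relation.Binary.PropositionalEquality using (_≡_; _≢_; refl; sym; cong; subst)
open import Function.Base using (_∘_)
open import Function.Bundles using (_⇔_; mk⇔)

open +-*-Solver using (solve; _:=_; _:+_; _:*_; con)
open ≤-Reasoning

InTail : (a d k m l i : ℕ) → Set
InTail a d k m l i =
  i ∈[ l ]
  × (∀ j → j ≤ k → i ≢ ap a d j)
  × (∀ j → j ≤ k → ap a d j < i → l ∸ i < m ∸ ap a d j)

∸<⇒<+ : ∀ {m n o} → m ∸ n < o → m < n + o
∸<⇒<+ {m} {n} m∸n<o = ≤-<-trans (m≤n+m∸n m n) (+-monoʳ-< n m∸n<o)

*-sucʳ-comm : ∀ d k → d * (k + 1) ≡ k * d + d
*-sucʳ-comm = solve 2 (λ d k → d :* (k :+ con 1) := k :* d :+ d) refl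

ap-mono : ∀ a d {j k} → j ≤ k → ap a d j ≤ ap a d k
ap-mono a d j≤k = +-monoʳ-≤ a (*-monoˡ-≤ d j≤k)

climb-step : ∀ a d {k l i j} → ap a d k + d ≤ suc l → j ≤ k →
  l ∸ i < ap a d k ∸ ap a d j → ap a d (suc j) ≤ i
climb-step a d {k} {l} {i} {j} long j≤k lt =
  +-cancelʳ-≤ (kd ∸ jd) (a + (d + jd)) i (begin
    a + (d + jd) + (kd ∸ jd)   ≡⟨ solve 4 (λ a d y x → a :+ (d :+ y) :+ x := a :+ (y :+ x) :+ d)
                                        refl a d jd (kd ∸ jd) ⟩
    a + (jd + (kd ∸ jd)) + d   ≡⟨ cong (λ x → a + x + d) (m+[n∸m]≡n (*-monoˡ-≤ d j≤k)) ⟩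
    a + kd + d                 ≤⟨ long ⟩
    suc l                      ≤⟨ ∸<⇒<+ (subst (l ∸ i <_) ([m+n]∸[m+o]≡n∸o a kd jd) lt) ⟩
    i + (kd ∸ jd)              ∎)
  where
  kd jd : ℕ
  kd = k * d
  jd = j * d

InTail-empty : ∀ {a d k l i} → ap a d k + d ≤ suc l → a ≤ i → ¬ InTail a d k (ap a d k) l i
InTail-empty {a} {d} {k} {l} {i} long a≤i (_ , avoids , cond) =
  n≮0 (subst (l ∸ i <_) (n∸n≡0 (ap a d k)) (cond k ≤-refl (passes k ≤-refl)))
  where
  passes : ∀ j → j ≤ k → ap a d j < i
  passes zero _ = ≤∧≢⇒< (subst (_≤ i) (sym (+-identityʳ a)) a≤i) (avoids 0 z≤n ∘ sym)
  passes (suc j) j<k =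
    ≤∧≢⇒< (climb-step a d long j≤k (cond j j≤k (passes j j≤k))) (avoids (suc j) j<k ∘ sym)
    where
    j≤k : j ≤ k
    j≤k = <⇒≤ j<k

long⇒IEmpty : ∀ {d k l} → d * (k + 1) ≤ l → IEmpty 1 d k (1 + k * d) l
long⇒IEmpty _ i (inj₁ (s≤s _ , ()))
long⇒IEmpty {d} {k} {l} long i (inj₂ tail@((1≤i , _) , _)) =
  InTail-empty (s≤s (subst (_≤ l) (*-sucʳ-comm d k) long)) 1≤i tail

IEmpty⇒a≡1 : ∀ {a d k m l} → 0 < a → IEmpty a d k m l → a ≡ 1
IEmpty⇒a≡1 {suc zero} _ _ = refl
IEmpty⇒a≡1 {suc (suc a)} _ empty = ⊥-elim (empty 1 (inj₁ (s≤s z≤n , s≤s z≤n)))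

past-last⇒InI : ∀ {a d k m l} → ap a d k < m → m ≤ l → InI a d k m l l
past-last⇒InI {a} {d} {k} {m} {l} last<m m≤l = inj₂ ((0<l , ≤-refl) , avoids , cond)
  where
  0<l : 0 < l
  0<l = <-≤-trans (≤-<-trans z≤n last<m) m≤l
  below-m : ∀ {j} → j ≤ k → ap a d j < m
  below-m j≤k = ≤-<-trans (ap-mono a d j≤k) last<m
  avoids : ∀ j → j ≤ k → l ≢ ap a d j
  avoids j j≤k e = <⇒≱ (below-m j≤k) (subst (m ≤_) e m≤l)
  cond : ∀ j → j ≤ k → ap a d j < l → l ∸ l < m ∸ ap a d j
  cond j j≤k _ = subst (_< m ∸ ap a d j) (sym (n∸n≡0 l)) (m<n⇒0<n∸m (below-m j≤k))

IEmpty⇒m≡last : ∀ {a d k m l} → ap a d k ≤ m → m ≤ l → IEmpty a d k m l → m ≡ ap a d k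
IEmpty⇒m≡last {l = l} last≤m m≤l empty with m≤n⇒m<n∨m≡n last≤m
... | inj₁ last<m = ⊥-elim (empty l (past-last⇒InI last<m m≤l))
... | inj₂ last≡m = sym last≡m

short⇒InI : ∀ {d k l} → 1 < d → 0 < k → k * d ≤ l → l < k * d + d →
  InI 1 d k (1 + k * d) l (k * d)
short⇒InI {d} {k} {l} 1<d 0<k kd≤l short =
  inj₂ ((*-mono-≤ 0<k (<⇒≤ 1<d) , kd≤l) , avoids , cond)
  where
  below : ∀ {j} → j < k → ap 1 d j < k * d
  below {j} j<k = ≤-trans (+-monoˡ-≤ (j * d) 1<d) (*-monoˡ-≤ d j<k)
  avoids : ∀ j → j ≤ k → k * d ≢ ap 1 d j
  avoids j j≤k e with m≤n⇒m<n∨m≡n j≤k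
  ... | inj₁ j<k = <-irrefl (sym e) (below j<k)
  ... | inj₂ refl = 1+n≢n (sym e)
  cond : ∀ j → j ≤ k → ap 1 d j < k * d → l ∸ k * d < (1 + k * d) ∸ ap 1 d j
  cond j j≤k ap<kd with m≤n⇒m<n∨m≡n j≤k
  ... | inj₁ j<k = <-≤-trans (m<n+o⇒m∸n<o l (k * d) {{>-nonZero (<-trans z<s 1<d)}} short)
                             (m+n≤o⇒m≤o∸n d (*-monoˡ-≤ d j<k))
  ... | inj₂ refl = ⊥-elim (<⇒≱ ap<kd (n≤1+n (k * d)))

IEmpty⇒long : ∀ {d k l} → 0 < d → 0 < k → 1 + k * d ≤ l → IEmpty 1 d k (1 + k * d) l →
  k * d + d ≤ l
IEmpty⇒long {d} {k} {l} 0<d 0<k m≤l empty with m≤n⇒m<n∨m≡n 0<d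
... | inj₂ refl = subst (_≤ l) (+-comm 1 (k * 1)) m≤l
... | inj₁ 1<d with k * d + d ≤? l
...   | yes long = long
...   | no ¬long = ⊥-elim (empty (k * d) (short⇒InI 1<d 0<k (<⇒≤ m≤l) (≰⇒> ¬long)))

corollary2 : (a d k m l : ℕ) → 0 < a → 0 < d → 0 < k → 0 < m → 0 < l →
    a + k * d ≤ m → m ≤ l →
    IEmpty a d k m l ⇔ (a ≡ 1 × m ≡ k * d + 1 × d * (k + 1) ≤ l)
corollary2 a d k m l 0<a 0<d 0<k _ _ last≤m m≤l = mk⇔ forward backward
  where
  forward : IEmpty a d k m l → a ≡ 1 × m ≡ k * d + 1 × d * (k + 1) ≤ l
  forward empty with IEmpty⇒a≡1 0<a empty
  ... | refl with IEmpty⇒m≡last last≤m m≤l empty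
  ...   | refl = refl , +-comm 1 (k * d) ,
                 subst (_≤ l) (sym (*-sucʳ-comm d k)) (IEmpty⇒long 0<d 0<k m≤l empty)
  backward : a ≡ 1 × m ≡ k * d + 1 × d * (k + 1) ≤ l → IEmpty a d k m l
  backward (refl , refl , long) =
    subst (λ m → IEmpty 1 d k m l) (+-comm 1 (k * d)) (long⇒IEmpty long)
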